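{- For every odd integer $k\ge 1$, $M_{k,\mathrm{T}\cdots\mathrm{F}}\ge 1.5\,\sqrt{2}^{\,k-1}$.
   Context: Unordered CNF game: an instance is a pair $(\varphi,X)$ where $\varphi$ is a CNF formula (a set of clauses, each clause a disjunction of literals $x_i$ or $\overline{x}_i$) and $X$ is a finite set of boolean variables containing every variable appearing in $\varphi$. Two players, T and F, alternate turns; on each turn the player picks a not-yet-assigned variable from $X$ and assigns it $0$ or $1$. The game ends when all variables are assigned; T wins if $\varphi$ is satisfied and F wins otherwise. A CNF is $k$-uniform if every clause has exactly $k$ literals, on $k$ distinct variables. $M_{k,\mathrm{T}\cdots\mathrm{F}}$ denotes the minimum number of clauses of $\varphi$ over all instances $(\varphi,X)$ with $\varphi$ $k$-uniform and $|X|$ even such that F has a winning strategy when T moves first (so F moves last). -}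

module Defs where

open import Data.Nat using (ℕ; zero; suc; _+_)
open import Data.Bool using (Bool; true; false; if_then_else_)
open import Data.Maybe using (Maybe; just; nothing; is-just)
open import Data.Fin using (Fin; _≟_)
open import Data.List using (List; map; allFin)
open import Data.Nat.ListAction using (sum)
open import Data.List.Relation.Unary.All using (All)
open import Data.Product using (∃; _×_)
open import Relation.Nullary using (¬_; yes; no)
open import Relation.Binary.PropositionalEquality using (_≡_)

-- A clause over the variables x₀ … x_{n-1} (the set X, identified with Fin n),
-- given as a set of literals: c i ≡ just true  means the literal x_i is in c,
-- c i ≡ just false means the literal x̄_i is in c, nothing means x_i does not occur.
-- (A k-uniform clause has k literals on k distinct variables, so no variable occurs
-- with both signs; this representation is thus exactly a set of literals.)
Clause : ℕ → Set
Clause n = Fin n → Maybe Bool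

width : ∀ {n} → Clause n → ℕ
width {n} c = sum (map (λ i → if is-just (c i) then 1 else 0) (allFin n))

Uniform : ℕ → ∀ {n} → Clause n → Set
Uniform k c = width c ≡ k

DistinctClauses : ∀ {n} → Clause n → Clause n → Set
DistinctClauses {n} c d = ¬ (∀ (i : Fin n) → c i ≡ d i)

-- CNF formula: a list of clauses (required pairwise distinct in the statement)
CNF : ℕ → Set
CNF n = List (Clause n)

-- partial assignment (game position): nothing = not yet assigned
PAssign : ℕ → Set
PAssign n = Fin n → Maybe Bool

empty : ∀ {n} → PAssign n
empty _ = nothing

update : ∀ {n} → PAssign n → Fin n → Bool → PAssign n
update σ i b j with j ≟ i
... | yes _ = just b
... | no  _ = σ j

Full : ∀ {n} → PAssign n → Set
Full {n} σ = ∀ (i : Fin n) → ¬ (σ i ≡ nothing)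

SatClause : ∀ {n} → PAssign n → Clause n → Set
SatClause σ c = ∃ λ i → ∃ λ b → (c i ≡ just b) × (σ i ≡ just b)

Satisfied : ∀ {n} → CNF n → PAssign n → Set
Satisfied φ σ = All (SatClause σ) φ

-- F has a winning strategy from position σ, with T (resp. F) to move.
-- Game ends when all variables are assigned; F wins iff φ is not satisfied.
mutual
  data FWinsTmove {n} (φ : CNF n) (σ : PAssign n) : Set where
    over : Full σ → ¬ Satisfied φ σ → FWinsTmove φ σ
    tmove : ¬ Full σ →
            (∀ (i : Fin n) (b : Bool) → σ i ≡ nothing → FWinsFmove φ (update σ i b)) →
            FWinsTmove φ σ

  data FWinsFmove {n} (φ : CNF n) (σ : PAssign n) : Set where
    over : Full σ → ¬ Satisfied φ σ → FWinsFmove φ σ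
    fmove : (i : Fin n) (b : Bool) → σ i ≡ nothing → FWinsTmove φ (update σ i b) →
            FWinsFmove φ σ

-- A potential argument in the style of Erdős–Selfridge. A clause with no true literal and d
-- false literals weighs 2^⌊d/2⌋ + 2^⌈d/2⌉ (roughly √2^d), a satisfied clause weighs 0, and the
-- potential is the total weight, 2|φ| at the start. T always plays the free move x := a of least
-- cost, where on each pending clause the move costs 0 if it satisfies it, the full weight if it
-- falsifies it, and 2^⌊d/2⌋ if x does not occur. Clause by clause, a round of T's move and F's
-- reply y := b raises the potential by at most cost(x := a) − cost(y := ¬b) ≤ 0, both costs
-- taken before T's move. If F wins, some clause ends with all k = 2m+1 literals false, so the
-- final potential is at least 2^m + 2^(m+1).

module Submission where

open import Defs
open import Data.Nat.Properties renaming (_≟_ to _≟ⁿ_)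
open import Algebra.Properties.CommutativeMonoid.Sum +-0-commutativeMonoid
  using (sum-syntax; sum-remove; sum-cong-≗; sum-replicate-zero; ∑-distrib-+)
  renaming (sum to ∑)
open import Algebra.Properties.CommutativeSemigroup +-commutativeSemigroup using (interchange)
open import Data.Bool using (Bool; true; false; not; if_then_else_)
open import Data.Bool.Properties using () renaming (_≟_ to _≟ᵇ_)
open import Data.Fin using (Fin; zero; suc; _≟_)
open import Data.Fin.Properties using (punchInᵢ≢i; ¬∀⟶∃¬)
open import Data.List using (List; []; _∷_; length; map; tabulate; filter; cartesianProduct; allFin)
open import Data.List.Extrema ≤-totalOrder using (argmin; argmin-all; f[argmin]≤f[xs])
open import Data.List.Membership.Propositional using (_∈_)
open import Data.List.Membership.Propositional.Properties
  using (∈-filter⁺; ∈-cartesianProduct⁺; ∈-allFin)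
open import Data.List.Properties using (map-tabulate)
open import Data.List.Relation.Unary.All using (All; []; _∷_; lookup)
open import Data.List.Relation.Unary.All.Properties using (all-filter)
open import Data.List.Relation.Unary.Any using (here; there)
open import Data.List.Relation.Unary.AllPairs using (AllPairs)
open import Data.Maybe using (Maybe; just; nothing; is-just)
open import Data.Maybe.Properties using (≡-dec)
open import Data.Nat using (ℕ; zero; suc; _+_; _*_; _^_; _≤_; _<_; z≤n; s≤s)
open import Data.Nat.Divisibility using (_∣_)
open import Data.Nat.ListAction using (sum)
open import Data.Nat.Tactic.RingSolver using (solve-∀)
open import Data.Product using (∃; _×_; _,_; proj₁; proj₂; map₂)
open import Data.Vec.Functional using (Vector; removeAt)
open import Function using (_∘_)
open import Relation.Binary.PropositionalEquality
open import Relation.Nullary using (¬_; yes; no; contradiction)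
open import Relation.Nullary.Decidable using (decidable-stable; ¬?)
open import Relation.Unary using (Decidable)

2^⌊_/2⌋ : ℕ → ℕ
2^⌊ zero /2⌋ = 1
2^⌊ suc zero /2⌋ = 1
2^⌊ suc (suc d) /2⌋ = 2 * 2^⌊ d /2⌋

2^⌊/2⌋-≤-suc : ∀ d → 2^⌊ d /2⌋ ≤ 2^⌊ suc d /2⌋
2^⌊/2⌋-≤-suc zero = ≤-refl
2^⌊/2⌋-≤-suc (suc zero) = s≤s z≤n
2^⌊/2⌋-≤-suc (suc (suc d)) = *-monoʳ-≤ 2 (2^⌊/2⌋-≤-suc d)

2^⌊2m/2⌋ : ∀ m → 2^⌊ 2 * m /2⌋ ≡ 2 ^ m
2^⌊2m/2⌋ zero = refl
2^⌊2m/2⌋ (suc m) = trans (cong 2^⌊_/2⌋ (*-suc 2 m)) (cong (2 *_) (2^⌊2m/2⌋ m))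

2^⌊2m+1/2⌋ : ∀ m → 2^⌊ suc (2 * m) /2⌋ ≡ 2 ^ m
2^⌊2m+1/2⌋ zero = refl
2^⌊2m+1/2⌋ (suc m) = trans (cong (2^⌊_/2⌋ ∘ suc) (*-suc 2 m)) (cong (2 *_) (2^⌊2m+1/2⌋ m))

weight : ℕ → ℕ
weight d = 2^⌊ d /2⌋ + 2^⌊ suc d /2⌋

weight-odd : ∀ m → weight (suc (2 * m)) ≡ 3 * 2 ^ m
weight-odd m = cong₂ (λ a b → a + 2 * b) (2^⌊2m+1/2⌋ m) (2^⌊2m/2⌋ m)

data Effect : Set where
  untouched satisfies falsifies : Effect

effect : Maybe Bool → Bool → Effect
effect nothing      _     = untouched
effect (just true)  true  = satisfies
effect (just true)  false = falsifies
effect (just false) true  = falsifies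
effect (just false) false = satisfies

opposite : Effect → Effect
opposite untouched = untouched
opposite satisfies = falsifies
opposite falsifies = satisfies

effect-not : ∀ l b → effect l (not b) ≡ opposite (effect l b)
effect-not nothing      _     = refl
effect-not (just true)  true  = refl
effect-not (just true)  false = refl
effect-not (just false) true  = refl
effect-not (just false) false = refl

trueCount falseCount : Effect → ℕ
trueCount satisfies = 1
trueCount _         = 0
falseCount falsifies = 1
falseCount _         = 0

-- pending d: no literal is true yet and d literals are false.
data Status : Set where
  satisfied : Status
  pending   : ℕ → Status

step : Effect → Status → Status
step _         satisfied   = satisfied
step untouched (pending d) = pending d
step satisfies (pending d) = satisfied
step falsifies (pending d) = pending (suc d)

clauseWeight : Status → ℕ
clauseWeight satisfied   = 0
clauseWeight (pending d) = weight d

moveCost : Effect → Status → ℕ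
moveCost _         satisfied   = 0
moveCost untouched (pending d) = 2^⌊ d /2⌋
moveCost satisfies (pending d) = 0
moveCost falsifies (pending d) = weight d

weight-step : ∀ e s →
  clauseWeight (step e s) + moveCost (opposite e) s ≤ clauseWeight s + moveCost e s
weight-step _         satisfied   = z≤n
weight-step untouched (pending d) = ≤-refl
weight-step satisfies (pending d) = ≤-reflexive (sym (+-identityʳ (weight d)))
weight-step falsifies (pending d) =
  ≤-trans (m≤m+n _ b) (≤-reflexive (identity a b))
  where
  a = 2^⌊ d /2⌋
  b = 2^⌊ suc d /2⌋
  identity : ∀ a b → b + 2 * a + 0 + b ≡ (a + b) + (a + b)
  identity = solve-∀

weight-step₂ : ∀ e e′ s →
  clauseWeight (step e′ (step e s)) + moveCost (opposite e′) s ≤ clauseWeight s + moveCost e s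
weight-step₂ _         _         satisfied   = z≤n
weight-step₂ untouched untouched (pending d) = ≤-refl
weight-step₂ untouched satisfies (pending d) = m≤m+n (weight d) _
weight-step₂ untouched falsifies (pending d) = ≤-reflexive (identity 2^⌊ d /2⌋ 2^⌊ suc d /2⌋)
  where
  identity : ∀ a b → b + 2 * a + 0 ≡ (a + b) + a
  identity = solve-∀
weight-step₂ satisfies untouched (pending d) = ≤-trans (m≤m+n _ _) (m≤m+n (weight d) 0)
weight-step₂ satisfies satisfies (pending d) = ≤-reflexive (sym (+-identityʳ (weight d)))
weight-step₂ satisfies falsifies (pending d) = z≤n
weight-step₂ falsifies untouched (pending d) = begin
  b + 2 * a + a        ≤⟨ +-monoʳ-≤ (b + 2 * a) (2^⌊/2⌋-≤-suc d) ⟩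
  b + 2 * a + b        ≡⟨ identity a b ⟩
  (a + b) + (a + b)    ∎
  where
  open ≤-Reasoning
  a = 2^⌊ d /2⌋
  b = 2^⌊ suc d /2⌋
  identity : ∀ a b → b + 2 * a + b ≡ (a + b) + (a + b)
  identity = solve-∀
weight-step₂ falsifies satisfies (pending d) = m≤n+m (weight d) (weight d)
weight-step₂ falsifies falsifies (pending d) = ≤-reflexive (identity 2^⌊ d /2⌋ 2^⌊ suc d /2⌋)
  where
  identity : ∀ a b → 2 * a + 2 * b + 0 ≡ (a + b) + (a + b)
  identity = solve-∀

update-self : ∀ {n} (σ : PAssign n) x b → update σ x b x ≡ just b
update-self σ x b with x ≟ x
... | yes _   = refl
... | no  x≢x = contradiction refl x≢x

update-other : ∀ {n} (σ : PAssign n) {x} b {i} → i ≢ x → update σ x b i ≡ σ i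
update-other σ {x} b {i} i≢x with i ≟ x
... | yes i≡x = contradiction i≡x i≢x
... | no  _   = refl

free-update⁻ : ∀ {n} (σ : PAssign n) {x} b {i} → update σ x b i ≡ nothing → σ i ≡ nothing
free-update⁻ σ {x} b {i} free with i ≟ x
free-update⁻ σ b ()   | yes _
free-update⁻ σ b free | no  _ = free

current : Maybe Bool → Maybe Bool → Effect
current _ nothing  = untouched
current l (just v) = effect l v

tally : ∀ {n} → (Effect → ℕ) → PAssign n → Clause n → ℕ
tally {n} κ σ c = ∑[ i < n ] κ (current (c i) (σ i))

sum-fill-zero : ∀ {n} (f g : Vector ℕ n) x → f x ≡ 0 → (∀ {i} → i ≢ x → g i ≡ f i) →
                ∑ g ≡ g x + ∑ f
sum-fill-zero {suc n} f g x fx≡0 g≗f = begin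
  ∑ g                                ≡⟨ sum-remove g ⟩
  g x + ∑ (removeAt g x)             ≡⟨ cong (g x +_) (sum-cong-≗ (λ j → g≗f (punchInᵢ≢i x j))) ⟩
  g x + ∑ (removeAt f x)             ≡⟨ cong (λ fx → g x + (fx + ∑ (removeAt f x))) fx≡0 ⟨
  g x + (f x + ∑ (removeAt f x))     ≡⟨ cong (g x +_) (sum-remove f) ⟨
  g x + ∑ f                          ∎
  where open ≡-Reasoning

tally-update : ∀ {n} κ (σ : PAssign n) c {x} a → κ untouched ≡ 0 → σ x ≡ nothing →
               tally κ (update σ x a) c ≡ κ (effect (c x) a) + tally κ σ c
tally-update κ σ c {x} a κ[untouched]≡0 free = begin
  tally κ (update σ x a) c                                 ≡⟨ sum-fill-zero _ _ x κ[σx]≡0 unchanged ⟩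
  κ (current (c x) (update σ x a x)) + tally κ σ c         ≡⟨ cong (λ s → κ (current (c x) s) + tally κ σ c) (update-self σ x a) ⟩
  κ (effect (c x) a) + tally κ σ c                         ∎
  where
  open ≡-Reasoning
  κ[σx]≡0 : κ (current (c x) (σ x)) ≡ 0
  κ[σx]≡0 = trans (cong (κ ∘ current (c x)) free) κ[untouched]≡0
  unchanged : ∀ {i} → i ≢ x → κ (current (c i) (update σ x a i)) ≡ κ (current (c i) (σ i))
  unchanged i≢x = cong (κ ∘ current (c _)) (update-other σ a i≢x)

statusOf : ℕ → ℕ → Status
statusOf zero    d = pending d
statusOf (suc _) _ = satisfied

status : ∀ {n} → PAssign n → Clause n → Status
status σ c = statusOf (tally trueCount σ c) (tally falseCount σ c)

statusOf-step : ∀ e t d → statusOf (trueCount e + t) (falseCount e + d) ≡ step e (statusOf t d)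
statusOf-step untouched zero    d = refl
statusOf-step untouched (suc t) d = refl
statusOf-step satisfies zero    d = refl
statusOf-step satisfies (suc t) d = refl
statusOf-step falsifies zero    d = refl
statusOf-step falsifies (suc t) d = refl

status-update : ∀ {n} (σ : PAssign n) c {x} a → σ x ≡ nothing →
                status (update σ x a) c ≡ step (effect (c x) a) (status σ c)
status-update σ c a free =
  trans (cong₂ statusOf (tally-update trueCount σ c a refl free) (tally-update falseCount σ c a refl free))
        (statusOf-step _ _ _)

status-empty : ∀ {n} (c : Clause n) → status empty c ≡ pending 0
status-empty {n} c = cong₂ statusOf (sum-replicate-zero n) (sum-replicate-zero n)

sum-tabulate : ∀ {n} (f : Vector ℕ n) → sum (tabulate f) ≡ ∑ f
sum-tabulate {zero}  f = refl
sum-tabulate {suc n} f = cong (f zero +_) (sum-tabulate (f ∘ suc))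

occurs : Maybe Bool → ℕ
occurs l = if is-just l then 1 else 0

width≡∑occurs : ∀ {n} (c : Clause n) → width c ≡ ∑[ i < n ] occurs (c i)
width≡∑occurs c = trans (cong sum (map-tabulate (λ i → i) (occurs ∘ c))) (sum-tabulate (occurs ∘ c))

current-counts : ∀ l {s} → s ≢ nothing → trueCount (current l s) + falseCount (current l s) ≡ occurs l
current-counts l            {nothing} assigned = contradiction refl assigned
current-counts nothing      {just _}  _ = refl
current-counts (just true)  {just true}  _ = refl
current-counts (just true)  {just false} _ = refl
current-counts (just false) {just true}  _ = refl
current-counts (just false) {just false} _ = refl

tally-full : ∀ {n} {σ : PAssign n} → Full σ → ∀ c →
             tally trueCount σ c + tally falseCount σ c ≡ width c
tally-full {σ = σ} full c = begin
  tally trueCount σ c + tally falseCount σ c  ≡⟨ ∑-distrib-+ (λ i → trueCount (current (c i) (σ i))) _ ⟨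
  ∑[ i < _ ] (trueCount (current (c i) (σ i)) + falseCount (current (c i) (σ i)))
                                              ≡⟨ sum-cong-≗ (λ i → current-counts (c i) (full i)) ⟩
  ∑[ i < _ ] occurs (c i)                     ≡⟨ width≡∑occurs c ⟨
  width c                                     ∎
  where open ≡-Reasoning

∑≢0⇒∃≢0 : ∀ {n} (f : Vector ℕ n) → ∑ f ≢ 0 → ∃ λ i → f i ≢ 0
∑≢0⇒∃≢0 {n} f ∑f≢0 = ¬∀⟶∃¬ n _ (λ i → f i ≟ⁿ 0) not-all-zero
  where
  not-all-zero : ¬ (∀ i → f i ≡ 0)
  not-all-zero f≗0 = ∑f≢0 (trans (sum-cong-≗ f≗0) (sum-replicate-zero n))

current-true : ∀ l s → trueCount (current l s) ≢ 0 → ∃ λ b → l ≡ just b × s ≡ just b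
current-true nothing      (just _)     t≢0 = contradiction refl t≢0
current-true (just true)  (just true)  _   = true , refl , refl
current-true (just true)  (just false) t≢0 = contradiction refl t≢0
current-true (just false) (just true)  t≢0 = contradiction refl t≢0
current-true (just false) (just false) _   = false , refl , refl
current-true _            nothing      t≢0 = contradiction refl t≢0

statusOf-satisfied : ∀ t d → statusOf t d ≡ satisfied → t ≢ 0
statusOf-satisfied zero    _ ()
statusOf-satisfied (suc _) _ _ ()

statusOf-pending : ∀ t d′ {d} → statusOf t d′ ≡ pending d → t ≡ 0 × d′ ≡ d
statusOf-pending zero _ refl = refl , refl

satisfied⇒SatClause : ∀ {n} (σ : PAssign n) c → status σ c ≡ satisfied → SatClause σ c
satisfied⇒SatClause σ c sat
  with ∑≢0⇒∃≢0 (λ i → trueCount (current (c i) (σ i))) (statusOf-satisfied _ _ sat)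
... | i , t≢0 = i , current-true (c i) (σ i) t≢0

pending-full : ∀ {n} {σ : PAssign n} → Full σ → ∀ c {d} → status σ c ≡ pending d → d ≡ width c
pending-full {σ = σ} full c eq with statusOf-pending (tally trueCount σ c) (tally falseCount σ c) eq
... | t≡0 , d′≡d = trans (sym d′≡d) (trans (cong (_+ tally falseCount σ c) (sym t≡0)) (tally-full full c))

light⇒SatClause : ∀ {n} {σ : PAssign n} {k} → Full σ → ∀ {c} → Uniform k c →
                  clauseWeight (status σ c) < weight k → SatClause σ c
light⇒SatClause {σ = σ} {k} full {c} uniform light with status σ c in eq
... | satisfied = satisfied⇒SatClause σ c eq
... | pending d = contradiction light (<-irrefl (cong weight d≡k))
  where
  d≡k : d ≡ k
  d≡k = trans (pending-full full c eq) uniform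

Move : ℕ → Set
Move n = Fin n × Bool

potential : ∀ {n} → CNF n → PAssign n → ℕ
potential φ σ = sum (map (λ c → clauseWeight (status σ c)) φ)

cost : ∀ {n} → CNF n → PAssign n → Move n → ℕ
cost φ σ (x , a) = sum (map (λ c → moveCost (effect (c x) a) (status σ c)) φ)

sum-map-+-mono-≤ : ∀ {A : Set} {f g h k : A → ℕ} (xs : List A) → (∀ x → f x + g x ≤ h x + k x) →
                   sum (map f xs) + sum (map g xs) ≤ sum (map h xs) + sum (map k xs)
sum-map-+-mono-≤ []       _  = z≤n
sum-map-+-mono-≤ {f = f} {g} {h} {k} (x ∷ xs) le = begin
  (f x + sum (map f xs)) + (g x + sum (map g xs))  ≡⟨ interchange (f x) _ (g x) _ ⟩
  (f x + g x) + (sum (map f xs) + sum (map g xs))  ≤⟨ +-mono-≤ (le x) (sum-map-+-mono-≤ xs le) ⟩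
  (h x + k x) + (sum (map h xs) + sum (map k xs))  ≡⟨ interchange (h x) (k x) _ _ ⟩
  (h x + sum (map h xs)) + (k x + sum (map k xs))  ∎
  where open ≤-Reasoning

potential-move : ∀ {n} (φ : CNF n) σ {x} a → σ x ≡ nothing →
                 potential φ (update σ x a) + cost φ σ (x , not a) ≤ potential φ σ + cost φ σ (x , a)
potential-move φ σ {x} a free = sum-map-+-mono-≤ φ per-clause
  where
  per-clause : ∀ c → clauseWeight (status (update σ x a) c) + moveCost (effect (c x) (not a)) (status σ c)
                   ≤ clauseWeight (status σ c) + moveCost (effect (c x) a) (status σ c)
  per-clause c = begin
    clauseWeight (status (update σ x a) c) + moveCost (effect (c x) (not a)) (status σ c)
      ≡⟨ cong₂ (λ s e → clauseWeight s + moveCost e (status σ c)) (status-update σ c a free) (effect-not (c x) a) ⟩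
    clauseWeight (step (effect (c x) a) (status σ c)) + moveCost (opposite (effect (c x) a)) (status σ c)
      ≤⟨ weight-step (effect (c x) a) (status σ c) ⟩
    clauseWeight (status σ c) + moveCost (effect (c x) a) (status σ c)  ∎
    where open ≤-Reasoning

potential-round : ∀ {n} (φ : CNF n) σ {x} a {y} b → σ x ≡ nothing → update σ x a y ≡ nothing →
                  potential φ (update (update σ x a) y b) + cost φ σ (y , not b)
                  ≤ potential φ σ + cost φ σ (x , a)
potential-round φ σ {x} a {y} b free-x free-y = sum-map-+-mono-≤ φ per-clause
  where
  per-clause : ∀ c → clauseWeight (status (update (update σ x a) y b) c) + moveCost (effect (c y) (not b)) (status σ c)
                   ≤ clauseWeight (status σ c) + moveCost (effect (c x) a) (status σ c)
  per-clause c = begin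
    clauseWeight (status (update (update σ x a) y b) c) + moveCost (effect (c y) (not b)) (status σ c)
      ≡⟨ cong₂ (λ s e → clauseWeight s + moveCost e (status σ c)) two-moves (effect-not (c y) b) ⟩
    clauseWeight (step ey (step ex (status σ c))) + moveCost (opposite ey) (status σ c)
      ≤⟨ weight-step₂ ex ey (status σ c) ⟩
    clauseWeight (status σ c) + moveCost ex (status σ c)  ∎
    where
    open ≤-Reasoning
    ex = effect (c x) a
    ey = effect (c y) b
    two-moves : status (update (update σ x a) y b) c ≡ step ey (step ex (status σ c))
    two-moves = trans (status-update (update σ x a) c b free-y) (cong (step ey) (status-update σ c a free-x))

potential-empty : ∀ {n} (φ : CNF n) → potential φ empty ≡ 2 * length φ
potential-empty []      = refl
potential-empty (c ∷ φ) =
  trans (cong₂ _+_ (cong clauseWeight (status-empty c)) (potential-empty φ)) (sym (*-suc 2 (length φ)))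

light⇒Satisfied : ∀ {n} {σ : PAssign n} {k} → Full σ → ∀ {φ} → All (Uniform k) φ →
                  potential φ σ < weight k → Satisfied φ σ
light⇒Satisfied full []                 _     = []
light⇒Satisfied full (uniform ∷ uniforms) light =
  light⇒SatClause full uniform (≤-<-trans (m≤m+n _ _) light) ∷
  light⇒Satisfied full uniforms (≤-<-trans (m≤n+m _ _) light)

Free : ∀ {n} → PAssign n → Move n → Set
Free σ m = σ (proj₁ m) ≡ nothing

free? : ∀ {n} (σ : PAssign n) → Decidable (Free σ)
free? σ m = ≡-dec _≟ᵇ_ (σ (proj₁ m)) nothing

allMoves : ∀ n → List (Move n)
allMoves n = cartesianProduct (allFin n) (true ∷ false ∷ [])

freeMoves : ∀ {n} → PAssign n → List (Move n)
freeMoves {n} σ = filter (free? σ) (allMoves n)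

∈-freeMoves : ∀ {n} (σ : PAssign n) {x} b → σ x ≡ nothing → (x , b) ∈ freeMoves σ
∈-freeMoves σ {x} b free = ∈-filter⁺ (free? σ) (∈-cartesianProduct⁺ (∈-allFin x) (∈-bools b)) free
  where
  ∈-bools : ∀ b → b ∈ true ∷ false ∷ []
  ∈-bools true  = here refl
  ∈-bools false = there (here refl)

some-free : ∀ {n} (σ : PAssign n) → ¬ Full σ → ∃ λ x → σ x ≡ nothing
some-free {n} σ notFull =
  map₂ (decidable-stable (free? σ (_ , true))) (¬∀⟶∃¬ n _ (λ x → ¬? (free? σ (x , true))) notFull)

cheapestMove : ∀ {n} (φ : CNF n) (σ : PAssign n) → ¬ Full σ →
               ∃ λ m → Free σ m × (∀ y b → σ y ≡ nothing → cost φ σ m ≤ cost φ σ (y , b))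
cheapestMove φ σ notFull =
  argmin (cost φ σ) m₀ (freeMoves σ) ,
  argmin-all (cost φ σ) {m₀} {freeMoves σ} free₀ (all-filter (free? σ) (allMoves _)) ,
  λ y b free → lookup (f[argmin]≤f[xs] {f = cost φ σ} m₀ (freeMoves σ)) (∈-freeMoves σ b free)
  where
  x₀ = proj₁ (some-free σ notFull)
  free₀ = proj₂ (some-free σ notFull)
  m₀ = x₀ , true

m+n≤o+p∧p≤n⇒m≤o : ∀ {m n o p} → m + n ≤ o + p → p ≤ n → m ≤ o
m+n≤o+p∧p≤n⇒m≤o {m} {n} {o} le p≤n = +-cancelʳ-≤ n m o (≤-trans le (+-monoʳ-≤ o p≤n))

mutual
  weight≤potential : ∀ {n k} {φ : CNF n} {σ} → All (Uniform k) φ → FWinsTmove φ σ →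
                     weight k ≤ potential φ σ
  weight≤potential uniform (over full unsat) = ≮⇒≥ (unsat ∘ light⇒Satisfied full uniform)
  weight≤potential {φ = φ} {σ} uniform (tmove notFull fWins) with cheapestMove φ σ notFull
  ... | (x , a) , free , cheapest = weight≤potential-cheapest uniform free cheapest (fWins x a free)

  weight≤potential-cheapest : ∀ {n k} {φ : CNF n} {σ x a} → All (Uniform k) φ → σ x ≡ nothing →
                              (∀ y b → σ y ≡ nothing → cost φ σ (x , a) ≤ cost φ σ (y , b)) →
                              FWinsFmove φ (update σ x a) → weight k ≤ potential φ σ
  weight≤potential-cheapest {φ = φ} {σ} {x} {a} uniform free cheapest (over full unsat) =
    ≤-trans (≮⇒≥ (unsat ∘ light⇒Satisfied full uniform))
            (m+n≤o+p∧p≤n⇒m≤o (potential-move φ σ a free) (cheapest x (not a) free))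
  weight≤potential-cheapest {φ = φ} {σ} {x} {a} uniform free cheapest (fmove y b free-y fWins) =
    ≤-trans (weight≤potential uniform fWins)
            (m+n≤o+p∧p≤n⇒m≤o (potential-round φ σ a b free free-y) (cheapest y (not b) (free-update⁻ σ a free-y)))

lemma9 : (m : ℕ) → (n : ℕ) → 2 ∣ n → (φ : CNF n) →
         AllPairs DistinctClauses φ → All (Uniform (suc (2 * m))) φ →
         FWinsTmove φ empty →
         3 * 2 ^ m ≤ 2 * length φ
lemma9 m n _ φ _ uniform fWins =
  subst₂ _≤_ (weight-odd m) (potential-empty φ) (weight≤potential uniform fWins)
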